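{- Let $n \geq 1$. For every Boolean function $f : \{0,1\}^n \to \{0,1\}$, we have $\lceil \log_2 \mu(f) \rceil = D^{\mathrm{comp}}(f)$.
   Context: Order $\{0,1\}^n$ lexicographically, i.e. compare strings as binary representations of integers in $\{0,\dots,2^n-1\}$ with the first bit most significant. $\mu(f)$ is the number of maximal blocks of consecutive equal values (maximal runs of zeroes and maximal runs of ones) in the length-$2^n$ sequence of values of $f$ listed in this order. For $x \in \{0,1\}^n$, the comparison function $\theta_x : \{0,1\}^n \to \{0,1\}$ is defined by $\theta_x(y) = 1$ if and only if $y \geq x$. A comparison decision tree is a rooted tree in which every internal vertex has exactly two children (via outgoing edges labeled $0$ and $1$) and is labeled by a query function which is either some $\theta_x$ ($x \in \{0,1\}^n$) or the constant $0$ function, and every leaf is labeled by an output in $\{0,1\}$. On input $y$, one starts at the root, at each internal vertex evaluates its query function on $y$ and follows the edge labeled by the result, and outputs the label of the leaf reached. The tree computes $f$ if this output equals $f(y)$ for every $y$. Its depth is the maximum number of internal vertices on a root-to-leaf path. $D^{\mathrm{comp}}(f)$ is the minimum depth of a comparison decision tree computing $f$. -}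

module Defs where

open import Data.Bool using (Bool; true; false; if_then_else_)
open import Data.Nat using (ℕ; zero; suc; _+_; _*_; _^_; _⊔_; _≤ᵇ_; _≤_)
open import Data.Product using (Σ; _×_)
open import Data.Vec using (Vec; []; _∷_)
open import Data.List using (List; []; _∷_; _++_; map)
open import Relation.Binary.PropositionalEquality using (_≡_)

bitsVal : ∀ {n} → Vec Bool n → ℕ
bitsVal {suc n} (b ∷ bs) = (if b then 1 else 0) * 2 ^ n + bitsVal bs
bitsVal {zero} [] = 0

allStrings : (n : ℕ) → List (Vec Bool n)
allStrings zero = [] ∷ []
allStrings (suc n) = map (false ∷_) (allStrings n) ++ map (true ∷_) (allStrings n)

_==_ : Bool → Bool → Bool
true == true = true
false == false = true
_ == _ = false

countChanges : Bool → List Bool → ℕ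
countChanges x [] = 0
countChanges x (y ∷ ys) = (if x == y then 0 else 1) + countChanges y ys

runs : List Bool → ℕ
runs [] = 0
runs (x ∷ xs) = suc (countChanges x xs)

μ : ∀ {n} → (Vec Bool n → Bool) → ℕ
μ {n} f = runs (map f (allStrings n))

θ : ∀ {n} → Vec Bool n → Vec Bool n → Bool
θ x y = bitsVal x ≤ᵇ bitsVal y

data Query (n : ℕ) : Set where
  cmp   : Vec Bool n → Query n
  const0 : Query n

query : ∀ {n} → Query n → Vec Bool n → Bool
query (cmp x) y = θ x y
query const0 y = false

data CTree (n : ℕ) : Set where
  leaf : Bool → CTree n
  node : Query n → CTree n → CTree n → CTree n

eval : ∀ {n} → CTree n → Vec Bool n → Bool
eval (leaf b) y = b
eval (node q t₀ t₁) y = if query q y then eval t₁ y else eval t₀ y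

depth : ∀ {n} → CTree n → ℕ
depth (leaf _) = 0
depth (node _ t₀ t₁) = suc (depth t₀ ⊔ depth t₁)

Computes : ∀ {n} → CTree n → (Vec Bool n → Bool) → Set
Computes t f = ∀ y → eval t y ≡ f y

IsDcomp : ∀ {n} → (Vec Bool n → Bool) → ℕ → Set
IsDcomp {n} f d =
  (Σ (CTree n) λ t → Computes t f × depth t ≡ d) × (∀ (t : CTree n) → Computes t f → d ≤ depth t)

-- A comparison query splits the lexicographically ordered domain into a lower and
-- an upper interval, and concatenation at most adds the run counts, so a tree of
-- depth d produces at most 2^d runs: hence ⌈log₂ μ(f)⌉ ≤ D^comp(f).  Conversely, a
-- sequence with at most 2^(d+1) runs is the concatenation of two sequences with at
-- most 2^d runs each; querying the first string of the second part and recursing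
-- yields a tree of depth ⌈log₂ μ(f)⌉.
module Submission where

open import Defs
open import Data.Bool using (Bool; true; false; if_then_else_)
open import Data.Nat using (ℕ; _≥_; zero; suc; _+_; _*_; _^_; _⊔_; _≤_; _<_; _≤ᵇ_; z≤n; s≤s; s≤s⁻¹; ⌈_/2⌉; ⌊_/2⌋)
open import Data.Nat.Properties
open import Data.Nat.Logarithm using (⌈log₂_⌉; ⌈log₂⌉-mono-≤; ⌈log₂2^n⌉≡n)
open import Data.Nat.Logarithm.Core using (⌈log2⌉)
open import Data.Nat.Induction using (<-wellFounded)
open import Induction.WellFounded using (Acc; acc)
open import Data.Vec using (Vec; []; _∷_)
open import Data.List using (List; []; _∷_; _++_; map)
open import Data.List.Properties using (map-++; map-cong; map-cong-local)
open import Data.List.Membership.Propositional using (_∈_)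
open import Data.List.Relation.Unary.Any using (here)
open import Data.List.Membership.Propositional.Properties using (∈-map⁺; ∈-++⁺ˡ; ∈-++⁺ʳ)
open import Data.List.Relation.Unary.All as All using (All; []; _∷_)
import Data.List.Relation.Unary.All.Properties as All
open import Data.List.Relation.Unary.AllPairs as AllPairs using (AllPairs; []; _∷_)
import Data.List.Relation.Unary.AllPairs.Properties as AllPairs
open import Data.Product using (Σ; ∃₂; _×_; _,_)
open import Function.Base using (_on_)
open import Relation.Nullary using (yes; no; contradiction)
open import Relation.Nullary.Reflects using (ofʸ; ofⁿ)
open import Relation.Binary.PropositionalEquality

n≤2^⌈log2⌉n : ∀ n (rec : Acc _<_ n) → n ≤ 2 ^ ⌈log2⌉ n rec
n≤2^⌈log2⌉n 0 _ = z≤n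
n≤2^⌈log2⌉n 1 _ = s≤s z≤n
n≤2^⌈log2⌉n (suc (suc n)) (acc rs) = begin
  suc (suc n)                   ≡⟨ cong (λ k → suc (suc k)) (sym (⌊n/2⌋+⌈n/2⌉≡n n)) ⟩
  suc (suc (⌊ n /2⌋ + c))       ≤⟨ s≤s (s≤s (+-monoˡ-≤ c (⌊n/2⌋≤⌈n/2⌉ n))) ⟩
  suc (suc (c + c))             ≡⟨ cong suc (sym (+-suc c c)) ⟩
  suc c + suc c                 ≡⟨ cong (suc c +_) (sym (*-identityˡ (suc c))) ⟩
  2 * suc c                     ≤⟨ *-monoʳ-≤ 2 (n≤2^⌈log2⌉n (suc c) (rs (⌈n/2⌉<n n))) ⟩
  2 * 2 ^ ⌈log2⌉ (suc c) _      ∎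
  where
    open ≤-Reasoning
    c = ⌈ n /2⌉

n≤2^⌈log₂n⌉ : ∀ n → n ≤ 2 ^ ⌈log₂ n ⌉
n≤2^⌈log₂n⌉ n = n≤2^⌈log2⌉n n (<-wellFounded n)

n≤2^m⇒⌈log₂n⌉≤m : ∀ {n} m → n ≤ 2 ^ m → ⌈log₂ n ⌉ ≤ m
n≤2^m⇒⌈log₂n⌉≤m m n≤2^m = ≤-trans (⌈log₂⌉-mono-≤ n≤2^m) (≤-reflexive (⌈log₂2^n⌉≡n m))

2^m+2^n≤2^[1+m⊔n] : ∀ m n → 2 ^ m + 2 ^ n ≤ 2 ^ suc (m ⊔ n)
2^m+2^n≤2^[1+m⊔n] m n = +-mono-≤ (^-monoʳ-≤ 2 (m≤m⊔n m n))
  (≤-trans (^-monoʳ-≤ 2 (m≤n⊔m m n)) (m≤m+n _ 0))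

change : Bool → Bool → ℕ
change b c = if b == c then 0 else 1

change≤1 : ∀ b c → change b c ≤ 1
change≤1 true  true  = z≤n
change≤1 true  false = ≤-refl
change≤1 false true  = ≤-refl
change≤1 false false = z≤n

change≡0⇒≡ : ∀ {b c} → change b c ≡ 0 → c ≡ b
change≡0⇒≡ {true}  {true}  _ = refl
change≡0⇒≡ {false} {false} _ = refl

countChanges-++ : ∀ b bs cs → countChanges b (bs ++ cs) ≤ countChanges b bs + runs cs
countChanges-++ b []       []       = z≤n
countChanges-++ b []       (c ∷ cs) = +-monoˡ-≤ (countChanges c cs) (change≤1 b c)
countChanges-++ b (c ∷ bs) cs = begin
  change b c + countChanges c (bs ++ cs)         ≤⟨ +-monoʳ-≤ (change b c) (countChanges-++ c bs cs) ⟩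
  change b c + (countChanges c bs + runs cs)     ≡⟨ sym (+-assoc (change b c) _ _) ⟩
  change b c + countChanges c bs + runs cs       ∎
  where open ≤-Reasoning

runs-++ : ∀ bs cs → runs (bs ++ cs) ≤ runs bs + runs cs
runs-++ []       cs = ≤-refl
runs-++ (b ∷ bs) cs = s≤s (countChanges-++ b bs cs)

countChanges-∷-same : ∀ {b c} cs → (b == c) ≡ true → countChanges b (c ∷ cs) ≡ countChanges c cs
countChanges-∷-same cs b==c = cong (λ k → (if k then 0 else 1) + countChanges _ cs) b==c

countChanges-∷-differ : ∀ {b c} cs → (b == c) ≡ false → countChanges b (c ∷ cs) ≡ suc (countChanges c cs)
countChanges-∷-differ cs b≠c = cong (λ k → (if k then 0 else 1) + countChanges _ cs) b≠c

countChanges-const : ∀ {A : Set} b (xs : List A) → countChanges b (map (λ _ → b) xs) ≡ 0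
countChanges-const b     []       = refl
countChanges-const true  (_ ∷ xs) = countChanges-const true xs
countChanges-const false (_ ∷ xs) = countChanges-const false xs

runs-const : ∀ {A : Set} b (xs : List A) → runs (map (λ _ → b) xs) ≤ 1
runs-const b []       = z≤n
runs-const b (_ ∷ xs) = s≤s (≤-reflexive (countChanges-const b xs))

module _ {A : Set} (f : A → Bool) where

  countChanges≡0⇒const : ∀ b xs → countChanges b (map f xs) ≡ 0 → All (λ y → f y ≡ b) xs
  countChanges≡0⇒const b []       _  = []
  countChanges≡0⇒const b (y ∷ ys) eq = fy≡b ∷ All.map (λ fz≡fy → trans fz≡fy fy≡b)
      (countChanges≡0⇒const (f y) ys (m+n≡0⇒n≡0 (change b (f y)) eq))
    where
      fy≡b : f y ≡ b
      fy≡b = change≡0⇒≡ (m+n≡0⇒m≡0 (change b (f y)) eq)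

  countChanges-split : ∀ x xs a c → countChanges (f x) (map f xs) ≤ a + c →
    ∃₂ λ p q → xs ≡ p ++ q × countChanges (f x) (map f p) ≤ a × runs (map f q) ≤ c
  countChanges-split x []       a c _ = [] , [] , refl , z≤n , z≤n
  countChanges-split x (y ∷ ys) a c h with f x == f y in fx==fy
  ... | true with countChanges-split y ys a c h
  ...   | p , q , refl , hp , hq =
          y ∷ p , q , refl , ≤-trans (≤-reflexive (countChanges-∷-same (map f p) fx==fy)) hp , hq
  countChanges-split x (y ∷ ys) zero    c h | false = [] , y ∷ ys , refl , z≤n , h
  countChanges-split x (y ∷ ys) (suc a) c h | false with countChanges-split y ys a c (s≤s⁻¹ h)
  ...   | p , q , refl , hp , hq =
          y ∷ p , q , refl , ≤-trans (≤-reflexive (countChanges-∷-differ (map f p) fx==fy)) (s≤s hp) , hq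

  runs-split : ∀ xs a c → runs (map f xs) ≤ a + c →
    ∃₂ λ p q → xs ≡ p ++ q × runs (map f p) ≤ a × runs (map f q) ≤ c
  runs-split []       a       c _ = [] , [] , refl , z≤n , z≤n
  runs-split (x ∷ xs) zero    c h = [] , x ∷ xs , refl , z≤n , h
  runs-split (x ∷ xs) (suc a) c h with countChanges-split x xs a c (s≤s⁻¹ h)
  ... | p , q , refl , hp , hq = x ∷ p , q , refl , s≤s hp , hq

allPairs-++⁻ : ∀ {A : Set} {R : A → A → Set} xs {ys} → AllPairs R (xs ++ ys) →
  AllPairs R xs × AllPairs R ys × All (λ x → All (R x) ys) xs
allPairs-++⁻ []       Rys          = [] , Rys , []
allPairs-++⁻ (x ∷ xs) (Rx ∷ Rxsys) with allPairs-++⁻ xs Rxsys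
... | Rxs , Rys , Rxsys′ = All.++⁻ˡ xs Rx ∷ Rxs , Rys , All.++⁻ʳ xs Rx ∷ Rxsys′

Ascending : ∀ {n} → List (Vec Bool n) → Set
Ascending = AllPairs (_<_ on bitsVal)

Agrees : ∀ {n} → CTree n → (Vec Bool n → Bool) → List (Vec Bool n) → Set
Agrees t f = All (λ y → eval t y ≡ f y)

split-ascending : ∀ {n} (k : ℕ) {xs : List (Vec Bool n)} → Ascending xs →
  ∃₂ λ p q → xs ≡ p ++ q × All (λ y → bitsVal y < k) p × All (λ y → k ≤ bitsVal y) q
split-ascending k {[]}     []         = [] , [] , refl , [] , []
split-ascending k {x ∷ xs} (x<xs ∷ asc) with k ≤? bitsVal x
... | yes k≤x = [] , x ∷ xs , refl , [] , k≤x ∷ All.map (λ x<y → ≤-trans k≤x (<⇒≤ x<y)) x<xs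
... | no  k≰x with split-ascending k asc
...   | p , q , refl , p<k , k≤q = x ∷ p , q , refl , ≰⇒> k≰x ∷ p<k , k≤q

θ-below : ∀ {n} {y z : Vec Bool n} → bitsVal y < bitsVal z → θ z y ≡ false
θ-below {y = y} {z} y<z with bitsVal z ≤ᵇ bitsVal y | ≤ᵇ-reflects-≤ (bitsVal z) (bitsVal y)
... | false | _        = refl
... | true  | ofʸ z≤y = contradiction z≤y (<⇒≱ y<z)

θ-above : ∀ {n} {y z : Vec Bool n} → bitsVal z ≤ bitsVal y → θ z y ≡ true
θ-above {y = y} {z} z≤y with bitsVal z ≤ᵇ bitsVal y | ≤ᵇ-reflects-≤ (bitsVal z) (bitsVal y)
... | true  | _        = refl
... | false | ofⁿ z≰y = contradiction z≤y z≰y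

module _ {n} (z : Vec Bool n) (t₀ t₁ : CTree n) {y : Vec Bool n} where

  eval-below : bitsVal y < bitsVal z → eval (node (cmp z) t₀ t₁) y ≡ eval t₀ y
  eval-below y<z = cong (λ b → if b then eval t₁ y else eval t₀ y) (θ-below {y = y} {z} y<z)

  eval-above : bitsVal z ≤ bitsVal y → eval (node (cmp z) t₀ t₁) y ≡ eval t₁ y
  eval-above z≤y = cong (λ b → if b then eval t₁ y else eval t₀ y) (θ-above {y = y} {z} z≤y)

map-eval-cmp : ∀ {n} (z : Vec Bool n) (t₀ t₁ : CTree n) p q →
  All (λ y → bitsVal y < bitsVal z) p → All (λ y → bitsVal z ≤ bitsVal y) q →
  map (eval (node (cmp z) t₀ t₁)) (p ++ q) ≡ map (eval t₀) p ++ map (eval t₁) q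
map-eval-cmp z t₀ t₁ p q p<z z≤q = trans (map-++ _ p q)
  (cong₂ _++_ (map-cong-local (All.map (eval-below z t₀ t₁) p<z))
              (map-cong-local (All.map (eval-above z t₀ t₁) z≤q)))

runs≤2^depth : ∀ {n} (t : CTree n) {xs} → Ascending xs → runs (map (eval t) xs) ≤ 2 ^ depth t
runs≤2^depth (leaf b) {xs} _ = runs-const b xs
runs≤2^depth (node const0 t₀ t₁) asc = begin
  runs (map (eval t₀) _)           ≤⟨ runs≤2^depth t₀ asc ⟩
  2 ^ depth t₀                     ≤⟨ m≤m+n _ _ ⟩
  2 ^ depth t₀ + 2 ^ depth t₁      ≤⟨ 2^m+2^n≤2^[1+m⊔n] (depth t₀) (depth t₁) ⟩
  2 ^ suc (depth t₀ ⊔ depth t₁)    ∎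
  where open ≤-Reasoning
runs≤2^depth (node (cmp z) t₀ t₁) asc with split-ascending (bitsVal z) asc
... | p , q , refl , p<z , z≤q with allPairs-++⁻ p asc
... | ascp , ascq , _ = begin
  runs (map (eval (node (cmp z) t₀ t₁)) (p ++ q))    ≡⟨ cong runs (map-eval-cmp z t₀ t₁ p q p<z z≤q) ⟩
  runs (map (eval t₀) p ++ map (eval t₁) q)          ≤⟨ runs-++ (map (eval t₀) p) (map (eval t₁) q) ⟩
  runs (map (eval t₀) p) + runs (map (eval t₁) q)    ≤⟨ +-mono-≤ (runs≤2^depth t₀ ascp) (runs≤2^depth t₁ ascq) ⟩
  2 ^ depth t₀ + 2 ^ depth t₁                        ≤⟨ 2^m+2^n≤2^[1+m⊔n] (depth t₀) (depth t₁) ⟩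
  2 ^ suc (depth t₀ ⊔ depth t₁)                      ∎
  where open ≤-Reasoning

join-at-threshold : ∀ {n} {f : Vec Bool n → Bool} (t₀ t₁ : CTree n) p q →
  All (λ y → All (λ z → bitsVal y < bitsVal z) q) p → Ascending q → Agrees t₀ f p → Agrees t₁ f q →
  Σ (CTree n) λ t → depth t ≤ suc (depth t₀ ⊔ depth t₁) × Agrees t f (p ++ q)
join-at-threshold t₀ t₁ p [] _ _ agree₀ _ =
  t₀ , ≤-trans (m≤m⊔n (depth t₀) (depth t₁)) (n≤1+n _) , All.++⁺ agree₀ []
join-at-threshold t₀ t₁ p (z ∷ q) p<zq (z<q ∷ _) agree₀ agree₁ =
  node (cmp z) t₀ t₁ , ≤-refl , All.++⁺ agreeBelow agreeAbove
  where
    agreeBelow : Agrees (node (cmp z) t₀ t₁) _ p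
    agreeBelow = All.zipWith (λ (y<zq , e) → trans (eval-below z t₀ t₁ (All.head y<zq)) e) (p<zq , agree₀)
    agreeAbove : Agrees (node (cmp z) t₀ t₁) _ (z ∷ q)
    agreeAbove = All.zipWith (λ (z≤y , e) → trans (eval-above z t₀ t₁ z≤y) e) (≤-refl ∷ All.map <⇒≤ z<q , agree₁)

runs≤2^⇒tree : ∀ {n} (f : Vec Bool n → Bool) d {xs} → Ascending xs → runs (map f xs) ≤ 2 ^ d →
  Σ (CTree n) λ t → depth t ≤ d × Agrees t f xs
runs≤2^⇒tree f d       {[]}     _ _ = leaf false , z≤n , []
runs≤2^⇒tree f zero    {x ∷ xs} _ h =
  leaf (f x) , z≤n , refl ∷ All.map sym (countChanges≡0⇒const f (f x) xs (n≤0⇒n≡0 (s≤s⁻¹ h)))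
runs≤2^⇒tree f (suc d) {xs} asc h
  with runs-split f xs (2 ^ d) (2 ^ d) (≤-trans h (≤-reflexive (cong (2 ^ d +_) (+-identityʳ (2 ^ d)))))
... | p , q , refl , hp , hq with allPairs-++⁻ p asc
... | ascp , ascq , p<q with runs≤2^⇒tree f d ascp hp | runs≤2^⇒tree f d ascq hq
... | t₀ , d₀ , agree₀ | t₁ , d₁ , agree₁ with join-at-threshold t₀ t₁ p q p<q ascq agree₀ agree₁
... | t , depth≤ , agree = t , ≤-trans depth≤ (s≤s (⊔-lub d₀ d₁)) , agree

bitsVal<2^n : ∀ {n} (y : Vec Bool n) → bitsVal y < 2 ^ n
bitsVal<2^n         []          = s≤s z≤n
bitsVal<2^n         (false ∷ y) = ≤-trans (bitsVal<2^n y) (m≤m+n _ _)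
bitsVal<2^n {suc n} (true ∷ y) rewrite +-identityʳ (2 ^ n) = +-monoʳ-< (2 ^ n) (bitsVal<2^n y)

allStrings-ascending : ∀ n → Ascending (allStrings n)
allStrings-ascending zero    = [] ∷ []
allStrings-ascending (suc n) = AllPairs.++⁺
  (AllPairs.map⁺ (allStrings-ascending n))
  (AllPairs.map⁺ (AllPairs.map (+-monoʳ-< (2 ^ n + 0)) (allStrings-ascending n)))
  (All.map⁺ (All.universal (λ y → All.map⁺ (All.universal (λ z → 0y<1z y z) _)) _))
  where
    0y<1z : ∀ y z → bitsVal (false ∷ y) < bitsVal (true ∷ z)
    0y<1z y z = ≤-trans (bitsVal<2^n y) (≤-trans (m≤m+n (2 ^ n) 0) (m≤m+n _ _))

∈-allStrings : ∀ {n} (y : Vec Bool n) → y ∈ allStrings n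
∈-allStrings         []          = here refl
∈-allStrings         (false ∷ y) = ∈-++⁺ˡ (∈-map⁺ (false ∷_) (∈-allStrings y))
∈-allStrings {suc n} (true ∷ y)  = ∈-++⁺ʳ (map (false ∷_) (allStrings n)) (∈-map⁺ (true ∷_) (∈-allStrings y))

μ≤2^depth : ∀ {n} {f : Vec Bool n → Bool} (t : CTree n) → Computes t f → μ f ≤ 2 ^ depth t
μ≤2^depth {n} t t-computes-f = begin
  runs (map _ (allStrings n))        ≡⟨ cong runs (map-cong (λ y → sym (t-computes-f y)) (allStrings n)) ⟩
  runs (map (eval t) (allStrings n)) ≤⟨ runs≤2^depth t (allStrings-ascending n) ⟩
  2 ^ depth t                        ∎
  where open ≤-Reasoning

mainTheorem2 : (n : ℕ) → n ≥ 1 → (f : Vec Bool n → Bool) →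
    IsDcomp f ⌈log₂ μ f ⌉
mainTheorem2 n _ f with runs≤2^⇒tree f ⌈log₂ μ f ⌉ (allStrings-ascending n) (n≤2^⌈log₂n⌉ (μ f))
... | t , depth≤ , agree = (t , t-computes-f , ≤-antisym depth≤ (optimal t t-computes-f)) , optimal
  where
    t-computes-f : Computes t f
    t-computes-f y = All.lookup agree (∈-allStrings y)
    optimal : ∀ t → Computes t f → ⌈log₂ μ f ⌉ ≤ depth t
    optimal t c = n≤2^m⇒⌈log₂n⌉≤m (depth t) (μ≤2^depth t c)
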